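{- Let $p,q$ be complex numbers with $p\neq0$, $q\neq0$, $p^2-4q\neq0$, and let $(u_n),(v_n)$ be as in the context. For all integers $r,s$ and nonnegative integers $n$ (positive in the second identity), the following hold as formal power series in $z$: \[ 2(p^2 -4q)^n\sum_{j = 0}^\infty u_{rj + s}^{2n} z^j= \sum_{i = 0}^{2n} (-1)^i\binom {2n}iq^{si} \frac{ -q^{s(2n - 2i) + ri} v_{(r - s)(2n - 2i)} z + v_{s(2n - 2i)} }{q^{2rn} z^2 - q^{ri} v_{r(2n - 2i)} z + 1}\,, \] \[ 2(p^2 -4q)^{n-1}\sum_{j = 0}^\infty u_{rj + s}^{2n - 1} z^j=\sum_{i = 0}^{2n - 1} (-1)^i\binom {2n - 1}iq^{si} \frac{q^{s(2n - 1 - 2i) + ri} u_{(r - s)(2n - 1 - 2i)} z + u_{s(2n - 1 - 2i)} }{q^{(2n - 1)r} z^2 - q^{ri} v_{r(2n - 1 - 2i)} z + 1}\,, \] \[ 2\sum_{j = 0}^\infty v_{rj + s}^n z^j =\sum_{i = 0}^n \binom niq^{si} \frac{ -q^{s(n - 2i) + ri} v_{(r - s)(n - 2i)} z + v_{s(n - 2i)} }{q^{rn} z^2 - q^{ri} v_{r(n - 2i)} z + 1}\,. \]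
   Context: For complex $p\neq0$, $q\neq0$, the Lucas sequences $(u_n)$ and $(v_n)$ are defined for all integers $n$ by $u_0=0,u_1=1$, $v_0=2,v_1=p$, and $x_n=px_{n-1}-qx_{n-2}$ (extended to negative indices by running the recurrence backwards). With $\alpha,\beta$ the distinct roots of $x^2-px+q$, one has $u_n=(\alpha^n-\beta^n)/(\alpha-\beta)$ and $v_n=\alpha^n+\beta^n$. The denominators have constant term $1$ and are invertible formal power series. -}

module Defs where

open import Level using (_⊔_)
open import Algebra.Bundles using (CommutativeRing)
open import Data.Nat as ℕ using (ℕ; zero; suc)
open import Data.Integer as ℤ using (ℤ; +_; -[1+_])
open import Data.List using (List; []; _∷_; _++_; length)
open import Data.Product using (_×_; _,_; proj₁; proj₂; ∃)
open import Relation.Nullary using (¬_)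

module Lucas {c ℓ} (R : CommutativeRing c ℓ) where
  open CommutativeRing R hiding (zero)

  natR : ℕ → Carrier
  natR zero = 0#
  natR (suc n) = 1# + natR n

  pow : Carrier → ℕ → Carrier
  pow x zero = 1#
  pow x (suc n) = x * pow x n

  zpow : Carrier → Carrier → ℤ → Carrier
  zpow q qinv (+ n) = pow q n
  zpow q qinv -[1+ n ] = pow qinv (suc n)

  sumTo : ℕ → (ℕ → Carrier) → Carrier
  sumTo zero f = f zero
  sumTo (suc n) f = sumTo n f + f (suc n)

  -- Field-theoretic assumptions standing in for the complex numbers:
  -- a nontrivial field of characteristic zero that is algebraically closed.

  evalPoly : List Carrier → Carrier → Carrier
  evalPoly [] x = 0#
  evalPoly (a ∷ cs) x = a + x * evalPoly cs x

  record IsAlgClosedFieldChar0 : Set (c ⊔ ℓ) where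
    field
      nontrivial : ¬ (1# ≈ 0#)
      inverses   : ∀ x → ¬ (x ≈ 0#) → ∃ λ y → x * y ≈ 1#
      char0      : ∀ n → ¬ (natR (suc n) ≈ 0#)
      algClosed  : ∀ (cs : List Carrier) → 1 ℕ.≤ length cs →
                   ∃ λ x → evalPoly (cs ++ (1# ∷ [])) x ≈ 0#

  -- Lucas sequences x_n = p x_{n-1} - q x_{n-2}, with initial values x0 x1,
  -- extended to negative n by running the recurrence backwards:
  -- x_{n-2} = qinv * (p x_{n-1} - x_n).

  fwd : (p q x0 x1 : Carrier) → ℕ → Carrier × Carrier
  fwd p q x0 x1 zero = x0 , x1
  fwd p q x0 x1 (suc n) with fwd p q x0 x1 n
  ... | (a , b) = b , (p * b - q * a)

  bwd : (p qinv x0 x1 : Carrier) → ℕ → Carrier × Carrier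
  bwd p qinv x0 x1 zero = x0 , x1
  bwd p qinv x0 x1 (suc k) with bwd p qinv x0 x1 k
  ... | (a , b) = qinv * (p * a - b) , a

  lucasSeq : (p q qinv x0 x1 : Carrier) → ℤ → Carrier
  lucasSeq p q qinv x0 x1 (+ n) = proj₁ (fwd p q x0 x1 n)
  lucasSeq p q qinv x0 x1 -[1+ k ] = proj₁ (bwd p qinv x0 x1 (suc k))

  U : (p q qinv : Carrier) → ℤ → Carrier
  U p q qinv = lucasSeq p q qinv 0# 1#

  V : (p q qinv : Carrier) → ℤ → Carrier
  V p q qinv = lucasSeq p q qinv (1# + 1#) p

  Series : Set c
  Series = ℕ → Carrier

  _≈ₛ_ : Series → Series → Set ℓ
  f ≈ₛ g = ∀ j → f j ≈ g j

  _•_ : Carrier → Series → Series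
  (a • f) j = a * f j

  _⋆_ : Series → Series → Series
  (f ⋆ g) n = sumTo n (λ k → f k * g (n ℕ.∸ k))

  sumS : ℕ → (ℕ → Series) → Series
  sumS N F j = sumTo N (λ i → F i j)

  quad : Carrier → Carrier → Carrier → Series
  quad a b d zero = a
  quad a b d (suc zero) = b
  quad a b d (suc (suc zero)) = d
  quad a b d (suc (suc (suc _))) = 0#

  -- multiplicative inverse of a series whose constant term is 1:
  -- g_0 = 1, g_n = - Σ_{k=1}^{n} f_k g_{n-k}.
  -- revInv f n = [g_n , g_{n-1} , ... , g_0]
  dotFrom : Series → ℕ → List Carrier → Carrier
  dotFrom f k [] = 0#
  dotFrom f k (x ∷ xs) = f k * x + dotFrom f (suc k) xs

  revInv : Series → ℕ → List Carrier
  revInv f zero = 1# ∷ []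
  revInv f (suc n) = (- dotFrom f 1 (revInv f n)) ∷ revInv f n

  headOr0 : List Carrier → Carrier
  headOr0 [] = 0#
  headOr0 (x ∷ _) = x

  inv1 : Series → Series
  inv1 f n = headOr0 (revInv f n)

  -- the fraction  N / D  (D with constant term 1)
  _⊘_ : Series → Series → Series
  N ⊘ D = N ⋆ inv1 D

-- Let α, β be the roots of x² − px + q; they exist by algebraic closedness and are distinct since
-- p² − 4q = (α − β)², and v_k = α^k + β^k, u_k = (α^k − β^k)/(α − β). For k = rj + s each left-hand
-- side is 2d(α^k + σβ^k)^N with σ = ±1. Expand it binomially and add the expansion to its reversal:
-- after extracting q^{si}, the i-th and (N−i)-th terms combine into X xʲ + Y yʲ with
-- x = α^{r(N−i)}β^{ri} and y = α^{ri}β^{r(N−i)}, so that xy = q^{rN} and x + y = q^{ri}v_{r(N−2i)}.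
-- The generating function of X xʲ + Y yʲ is (X + Y − (Xy + Yx)z)/(1 − (x + y)z + xyz²), and
-- X + Y and Xy + Yx are again values of u or v.

module Submission where

open import Defs
open import Algebra.Bundles using (CommutativeRing)
open import Data.Nat as ℕ using (ℕ; zero; suc; _∸_; s≤s)
import Data.Nat.Properties as ℕ
open import Data.Nat.Combinatorics using (_C_; nCk≡nC[n∸k])
open import Data.Integer as ℤ using (ℤ; +_; -[1+_]; _⊖_)
import Data.Integer.Properties as ℤ
import Data.Integer.Tactic.RingSolver as ℤ-Solver
open import Data.Fin as Fin using (Fin; toℕ)
open import Data.List using ([]; _∷_)
open import Data.Maybe using (Maybe; just; nothing)
open import Data.Product using (∃; ∃₂; _×_; _,_; proj₁; proj₂)
open import Relation.Nullary using (¬_; yes; no)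
open import Relation.Binary.PropositionalEquality as ≡ using (_≡_)
import Algebra.Solver.Ring as RingSolver
import Algebra.Solver.Ring.AlmostCommutativeRing as ACR

as-⊖ : ∀ i → ∃₂ λ a b → i ≡ a ⊖ b
as-⊖ (+ n)    = n , 0 , ≡.refl
as-⊖ -[1+ n ] = 0 , suc n , ≡.refl

pos-∸ : ∀ {m n} → n ℕ.≤ m → + (m ∸ n) ≡ + m ℤ.- + n
pos-∸ {m} {n} n≤m = ≡.trans (≡.sym (ℤ.⊖-≥ n≤m)) (≡.sym (ℤ.m-n≡m⊖n m n))

⊖-+-⊖ : ∀ a b c d → (a ⊖ b) ℤ.+ (c ⊖ d) ≡ (a ℕ.+ c) ⊖ (b ℕ.+ d)
⊖-+-⊖ a b c d = begin
  (a ⊖ b) ℤ.+ (c ⊖ d)               ≡⟨ ≡.cong₂ ℤ._+_ (ℤ.m-n≡m⊖n a b) (ℤ.m-n≡m⊖n c d) ⟨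
  (+ a ℤ.- + b) ℤ.+ (+ c ℤ.- + d)   ≡⟨ interchange (+ a) (+ b) (+ c) (+ d) ⟩
  (+ a ℤ.+ + c) ℤ.- (+ b ℤ.+ + d)   ≡⟨ ≡.cong₂ ℤ._-_ (ℤ.pos-+ a c) (ℤ.pos-+ b d) ⟨
  + (a ℕ.+ c) ℤ.- + (b ℕ.+ d)       ≡⟨ ℤ.m-n≡m⊖n (a ℕ.+ c) (b ℕ.+ d) ⟩
  (a ℕ.+ c) ⊖ (b ℕ.+ d)             ∎
  where
  open ≡.≡-Reasoning
  interchange : ∀ w x y z → (w ℤ.- x) ℤ.+ (y ℤ.- z) ≡ (w ℤ.+ y) ℤ.- (x ℤ.+ z)
  interchange = ℤ-Solver.solve-∀

⊖-*-⊖ : ∀ a b c d → (a ⊖ b) ℤ.* (c ⊖ d) ≡ (a ℕ.* c ℕ.+ b ℕ.* d) ⊖ (a ℕ.* d ℕ.+ b ℕ.* c)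
⊖-*-⊖ a b c d = begin
  (a ⊖ b) ℤ.* (c ⊖ d)                                       ≡⟨ ≡.cong₂ ℤ._*_ (ℤ.m-n≡m⊖n a b) (ℤ.m-n≡m⊖n c d) ⟨
  (+ a ℤ.- + b) ℤ.* (+ c ℤ.- + d)                           ≡⟨ expand (+ a) (+ b) (+ c) (+ d) ⟩
  (+ a ℤ.* + c ℤ.+ + b ℤ.* + d) ℤ.- (+ a ℤ.* + d ℤ.+ + b ℤ.* + c)
    ≡⟨ ≡.cong₂ ℤ._-_ (pos-*+* a c b d) (pos-*+* a d b c) ⟨
  + (a ℕ.* c ℕ.+ b ℕ.* d) ℤ.- + (a ℕ.* d ℕ.+ b ℕ.* c)     ≡⟨ ℤ.m-n≡m⊖n (a ℕ.* c ℕ.+ b ℕ.* d) (a ℕ.* d ℕ.+ b ℕ.* c) ⟩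
  (a ℕ.* c ℕ.+ b ℕ.* d) ⊖ (a ℕ.* d ℕ.+ b ℕ.* c)           ∎
  where
  open ≡.≡-Reasoning
  expand : ∀ w x y z → (w ℤ.- x) ℤ.* (y ℤ.- z) ≡ (w ℤ.* y ℤ.+ x ℤ.* z) ℤ.- (w ℤ.* z ℤ.+ x ℤ.* y)
  expand = ℤ-Solver.solve-∀
  pos-*+* : ∀ a b c d → + (a ℕ.* b ℕ.+ c ℕ.* d) ≡ + a ℤ.* + b ℤ.+ + c ℤ.* + d
  pos-*+* a b c d = ≡.trans (ℤ.pos-+ (a ℕ.* b) (c ℕ.* d)) (≡.cong₂ ℤ._+_ (ℤ.pos-* a b) (ℤ.pos-* c d))

module _ {c ℓ} (R : CommutativeRing c ℓ) where
  open CommutativeRing R hiding (zero)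
  open Lucas R
  open import Relation.Binary.Reasoning.Setoid setoid
  open import Algebra.Properties.Ring ring using (-0#≈0#; -‿involutive; -1*x≈-x; -‿distribˡ-*; -‿distribʳ-*)
  open import Algebra.Properties.AbelianGroup +-abelianGroup using (⁻¹-∙-comm)
  open import Algebra.Properties.CommutativeSemigroup +-commutativeSemigroup using (interchange)
  open import Algebra.Properties.Semiring.Mult semiring
    using (×-homo-+; ×1-homo-*; ×-assoc-*; ×-congʳ) renaming (_×_ to _×ᵣ_)
  open import Algebra.Properties.Semiring.Exp semiring using (_^_; ^-congˡ; ^-homo-*)
  open import Algebra.Properties.CommutativeSemiring.Exp commutativeSemiring using (^-distrib-*)
  open import Algebra.Properties.Monoid.Sum +-monoid using (sum)
  import Algebra.Properties.CommutativeSemiring.Binomial commutativeSemiring as Binomial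

  natR≡× : ∀ n → natR n ≡ n ×ᵣ 1#
  natR≡× zero    = ≡.refl
  natR≡× (suc n) = ≡.cong (_+_ 1#) (natR≡× n)

  natR-+ : ∀ m n → natR (m ℕ.+ n) ≈ natR m + natR n
  natR-+ m n rewrite natR≡× (m ℕ.+ n) | natR≡× m | natR≡× n = ×-homo-+ 1# m n

  natR-* : ∀ m n → natR (m ℕ.* n) ≈ natR m * natR n
  natR-* m n rewrite natR≡× (m ℕ.* n) | natR≡× m | natR≡× n = ×1-homo-* m n

  -- The ring solver below computes with integer coefficients, interpreted in R by ⟦_⟧ℤ.
  ⟦_⟧ℤ : ℤ → Carrier
  ⟦ + n ⟧ℤ    = natR n
  ⟦ -[1+ n ] ⟧ℤ = - natR (suc n)

  -+-cancelˡ : ∀ a x y → (a + x) - (a + y) ≈ x - y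
  -+-cancelˡ a x y = begin
    (a + x) - (a + y)      ≈⟨ +-congˡ (⁻¹-∙-comm a y) ⟨
    (a + x) + (- a + - y)  ≈⟨ interchange a x (- a) (- y) ⟩
    (a - a) + (x - y)      ≈⟨ +-congʳ (-‿inverseʳ a) ⟩
    0# + (x - y)           ≈⟨ +-identityˡ _ ⟩
    x - y                  ∎

  ⟦⊖⟧ : ∀ a b → ⟦ a ⊖ b ⟧ℤ ≈ natR a - natR b
  ⟦⊖⟧ zero    zero    = sym (-‿inverseʳ 0#)
  ⟦⊖⟧ zero    (suc b) = sym (+-identityˡ _)
  ⟦⊖⟧ (suc a) zero    = sym (trans (+-congˡ -0#≈0#) (+-identityʳ _))
  ⟦⊖⟧ (suc a) (suc b) rewrite ℤ.[1+m]⊖[1+n]≡m⊖n a b = trans (⟦⊖⟧ a b) (sym (-+-cancelˡ 1# _ _))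

  -+-distrib : ∀ a b x y → (a - b) + (x - y) ≈ (a + x) - (b + y)
  -+-distrib a b x y = trans (interchange a (- b) x (- y)) (+-congˡ (⁻¹-∙-comm b y))

  -*-expand : ∀ a b x y → (a - b) * (x - y) ≈ (a * x + b * y) - (a * y + b * x)
  -*-expand a b x y = begin
    (a - b) * (x - y)                               ≈⟨ distribʳ _ _ _ ⟩
    a * (x - y) + - b * (x - y)                     ≈⟨ +-cong (distribˡ _ _ _) (distribˡ _ _ _) ⟩
    (a * x + a * - y) + (- b * x + - b * - y)       ≈⟨ +-congˡ (+-comm _ _) ⟩
    (a * x + a * - y) + (- b * - y + - b * x)       ≈⟨ interchange _ _ _ _ ⟩
    (a * x + - b * - y) + (a * - y + - b * x)       ≈⟨ +-cong (+-congˡ neg*neg) (+-cong (sym (-‿distribʳ-* a y)) (sym (-‿distribˡ-* b x))) ⟩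
    (a * x + b * y) + (- (a * y) + - (b * x))       ≈⟨ +-congˡ (⁻¹-∙-comm _ _) ⟩
    (a * x + b * y) - (a * y + b * x)               ∎
    where
    neg*neg : - b * - y ≈ b * y
    neg*neg = trans (sym (-‿distribˡ-* b (- y))) (trans (-‿cong (sym (-‿distribʳ-* b y))) (-‿involutive _))

  ⟦⟧ℤ-+ : ∀ i j → ⟦ i ℤ.+ j ⟧ℤ ≈ ⟦ i ⟧ℤ + ⟦ j ⟧ℤ
  ⟦⟧ℤ-+ i j with as-⊖ i | as-⊖ j
  ... | a , b , ≡.refl | c , d , ≡.refl = begin
    ⟦ (a ⊖ b) ℤ.+ (c ⊖ d) ⟧ℤ                  ≡⟨ ≡.cong ⟦_⟧ℤ (⊖-+-⊖ a b c d) ⟩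
    ⟦ (a ℕ.+ c) ⊖ (b ℕ.+ d) ⟧ℤ                ≈⟨ ⟦⊖⟧ (a ℕ.+ c) (b ℕ.+ d) ⟩
    natR (a ℕ.+ c) - natR (b ℕ.+ d)           ≈⟨ +-cong (natR-+ a c) (-‿cong (natR-+ b d)) ⟩
    (natR a + natR c) - (natR b + natR d)     ≈⟨ -+-distrib _ _ _ _ ⟨
    (natR a - natR b) + (natR c - natR d)     ≈⟨ +-cong (⟦⊖⟧ a b) (⟦⊖⟧ c d) ⟨
    ⟦ a ⊖ b ⟧ℤ + ⟦ c ⊖ d ⟧ℤ                   ∎

  ⟦⟧ℤ-* : ∀ i j → ⟦ i ℤ.* j ⟧ℤ ≈ ⟦ i ⟧ℤ * ⟦ j ⟧ℤ
  ⟦⟧ℤ-* i j with as-⊖ i | as-⊖ j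
  ... | a , b , ≡.refl | c , d , ≡.refl = begin
    ⟦ (a ⊖ b) ℤ.* (c ⊖ d) ⟧ℤ                                     ≡⟨ ≡.cong ⟦_⟧ℤ (⊖-*-⊖ a b c d) ⟩
    ⟦ (a ℕ.* c ℕ.+ b ℕ.* d) ⊖ (a ℕ.* d ℕ.+ b ℕ.* c) ⟧ℤ          ≈⟨ ⟦⊖⟧ (a ℕ.* c ℕ.+ b ℕ.* d) (a ℕ.* d ℕ.+ b ℕ.* c) ⟩
    natR (a ℕ.* c ℕ.+ b ℕ.* d) - natR (a ℕ.* d ℕ.+ b ℕ.* c)     ≈⟨ +-cong (natR-*+* a c b d) (-‿cong (natR-*+* a d b c)) ⟩
    (natR a * natR c + natR b * natR d) - (natR a * natR d + natR b * natR c) ≈⟨ -*-expand _ _ _ _ ⟨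
    (natR a - natR b) * (natR c - natR d)                       ≈⟨ *-cong (⟦⊖⟧ a b) (⟦⊖⟧ c d) ⟨
    ⟦ a ⊖ b ⟧ℤ * ⟦ c ⊖ d ⟧ℤ                                     ∎
    where
    natR-*+* : ∀ a b c d → natR (a ℕ.* b ℕ.+ c ℕ.* d) ≈ natR a * natR b + natR c * natR d
    natR-*+* a b c d = trans (natR-+ (a ℕ.* b) (c ℕ.* d)) (+-cong (natR-* a b) (natR-* c d))

  ⟦⟧ℤ-neg : ∀ i → ⟦ ℤ.- i ⟧ℤ ≈ - ⟦ i ⟧ℤ
  ⟦⟧ℤ-neg i with as-⊖ i
  ... | a , b , ≡.refl = begin
    ⟦ ℤ.- (a ⊖ b) ⟧ℤ      ≡⟨ ≡.cong ⟦_⟧ℤ (ℤ.⊖-swap b a) ⟨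
    ⟦ b ⊖ a ⟧ℤ            ≈⟨ ⟦⊖⟧ b a ⟩
    natR b - natR a       ≈⟨ trans (+-comm _ _) (+-congˡ (sym (-‿involutive _))) ⟩
    - natR a - - natR b   ≈⟨ ⁻¹-∙-comm _ _ ⟩
    - (natR a - natR b)   ≈⟨ -‿cong (⟦⊖⟧ a b) ⟨
    - ⟦ a ⊖ b ⟧ℤ          ∎

  ℤ-algebra : ℤ.+-*-rawRing ACR.-Raw-AlmostCommutative⟶ ACR.fromCommutativeRing R
  ℤ-algebra = record
    { ⟦_⟧ = ⟦_⟧ℤ ; +-homo = ⟦⟧ℤ-+ ; *-homo = ⟦⟧ℤ-* ; -‿homo = ⟦⟧ℤ-neg
    ; 0-homo = refl ; 1-homo = +-identityʳ 1# }

  ℤ-coefficient≟ : ∀ i j → Maybe (⟦ i ⟧ℤ ≈ ⟦ j ⟧ℤ)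
  ℤ-coefficient≟ i j with i ℤ.≟ j
  ... | yes ≡.refl = just refl
  ... | no _       = nothing

  open RingSolver ℤ.+-*-rawRing (ACR.fromCommutativeRing R) ℤ-algebra ℤ-coefficient≟
    using (solve; _:=_; _:+_; _:*_; :-_; _:-_; con)

  pow≡^ : ∀ x n → pow x n ≡ x ^ n
  pow≡^ x zero    = ≡.refl
  pow≡^ x (suc n) = ≡.cong (_*_ x) (pow≡^ x n)

  pow-congˡ : ∀ n {x y} → x ≈ y → pow x n ≈ pow y n
  pow-congˡ n {x} {y} x≈y rewrite pow≡^ x n | pow≡^ y n = ^-congˡ n x≈y

  pow-+ : ∀ x m n → pow x (m ℕ.+ n) ≈ pow x m * pow x n
  pow-+ x m n rewrite pow≡^ x (m ℕ.+ n) | pow≡^ x m | pow≡^ x n = ^-homo-* x m n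

  pow-* : ∀ x y n → pow (x * y) n ≈ pow x n * pow y n
  pow-* x y n rewrite pow≡^ (x * y) n | pow≡^ x n | pow≡^ y n = ^-distrib-* x y n

  pow-1# : ∀ n → pow 1# n ≈ 1#
  pow-1# zero    = refl
  pow-1# (suc n) = trans (*-identityˡ _) (pow-1# n)

  pow-inverse : ∀ {x y} n → x * y ≈ 1# → pow x n * pow y n ≈ 1#
  pow-inverse {x} {y} n x*y≈1 = trans (sym (pow-* x y n)) (trans (pow-congˡ n x*y≈1) (pow-1# n))

  pow-double : ∀ x n → pow x (2 ℕ.* n) ≈ pow (x * x) n
  pow-double x n = begin
    pow x (n ℕ.+ (n ℕ.+ 0))   ≡⟨ ≡.cong (λ t → pow x (n ℕ.+ t)) (ℕ.+-identityʳ n) ⟩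
    pow x (n ℕ.+ n)           ≈⟨ pow-+ x n n ⟩
    pow x n * pow x n         ≈⟨ pow-* x x n ⟨
    pow (x * x) n             ∎

  zpow-cong : ∀ {x y x⁻¹ y⁻¹} i → x ≈ y → x⁻¹ ≈ y⁻¹ → zpow x x⁻¹ i ≈ zpow y y⁻¹ i
  zpow-cong (+ n)    x≈y _       = pow-congˡ n x≈y
  zpow-cong -[1+ n ] _ x⁻¹≈y⁻¹ = pow-congˡ (suc n) x⁻¹≈y⁻¹

  zpow-* : ∀ x x⁻¹ y y⁻¹ i → zpow (x * y) (x⁻¹ * y⁻¹) i ≈ zpow x x⁻¹ i * zpow y y⁻¹ i
  zpow-* x x⁻¹ y y⁻¹ (+ n)    = pow-* x y n
  zpow-* x x⁻¹ y y⁻¹ -[1+ n ] = pow-* x⁻¹ y⁻¹ (suc n)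

  zpow-⊖ : ∀ {x x⁻¹} → x * x⁻¹ ≈ 1# → ∀ a b → zpow x x⁻¹ (a ⊖ b) ≈ pow x a * pow x⁻¹ b
  zpow-⊖ _ zero    zero    = sym (*-identityˡ _)
  zpow-⊖ _ zero    (suc b) = sym (*-identityˡ _)
  zpow-⊖ _ (suc a) zero    = sym (*-identityʳ _)
  zpow-⊖ {x} {x⁻¹} x*x⁻¹≈1 (suc a) (suc b) rewrite ℤ.[1+m]⊖[1+n]≡m⊖n a b = begin
    zpow x x⁻¹ (a ⊖ b)                      ≈⟨ zpow-⊖ x*x⁻¹≈1 a b ⟩
    pow x a * pow x⁻¹ b                     ≈⟨ *-identityˡ _ ⟨
    1# * (pow x a * pow x⁻¹ b)              ≈⟨ *-congʳ x*x⁻¹≈1 ⟨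
    (x * x⁻¹) * (pow x a * pow x⁻¹ b)       ≈⟨ solve 4 (λ x y a b → (x :* y) :* (a :* b) := (x :* a) :* (y :* b)) refl x x⁻¹ _ _ ⟩
    (x * pow x a) * (x⁻¹ * pow x⁻¹ b)       ∎

  zpow-+ : ∀ {x x⁻¹} → x * x⁻¹ ≈ 1# → ∀ i j → zpow x x⁻¹ (i ℤ.+ j) ≈ zpow x x⁻¹ i * zpow x x⁻¹ j
  zpow-+ {x} {x⁻¹} inv i j with as-⊖ i | as-⊖ j
  ... | a , b , ≡.refl | c , d , ≡.refl = begin
    zpow x x⁻¹ ((a ⊖ b) ℤ.+ (c ⊖ d))                  ≡⟨ ≡.cong (zpow x x⁻¹) (⊖-+-⊖ a b c d) ⟩
    zpow x x⁻¹ ((a ℕ.+ c) ⊖ (b ℕ.+ d))                ≈⟨ zpow-⊖ inv (a ℕ.+ c) (b ℕ.+ d) ⟩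
    pow x (a ℕ.+ c) * pow x⁻¹ (b ℕ.+ d)               ≈⟨ *-cong (pow-+ x a c) (pow-+ x⁻¹ b d) ⟩
    (pow x a * pow x c) * (pow x⁻¹ b * pow x⁻¹ d)     ≈⟨ solve 4 (λ a c b d → (a :* c) :* (b :* d) := (a :* b) :* (c :* d)) refl _ _ _ _ ⟩
    (pow x a * pow x⁻¹ b) * (pow x c * pow x⁻¹ d)     ≈⟨ *-cong (zpow-⊖ inv a b) (zpow-⊖ inv c d) ⟨
    zpow x x⁻¹ (a ⊖ b) * zpow x x⁻¹ (c ⊖ d)           ∎

  zpow-pow : ∀ {x x⁻¹} → x * x⁻¹ ≈ 1# → ∀ i n → zpow x x⁻¹ (i ℤ.* + n) ≈ pow (zpow x x⁻¹ i) n
  zpow-pow {x} {x⁻¹} inv i zero rewrite ℤ.*-zeroʳ i = refl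
  zpow-pow {x} {x⁻¹} inv i (suc n) = begin
    zpow x x⁻¹ (i ℤ.* + suc n)                ≡⟨ ≡.cong (zpow x x⁻¹) (*-suc i n) ⟩
    zpow x x⁻¹ (i ℤ.+ i ℤ.* + n)              ≈⟨ zpow-+ inv i (i ℤ.* + n) ⟩
    zpow x x⁻¹ i * zpow x x⁻¹ (i ℤ.* + n)     ≈⟨ *-congˡ (zpow-pow inv i n) ⟩
    zpow x x⁻¹ i * pow (zpow x x⁻¹ i) n       ∎
    where
    *-suc : ∀ i n → i ℤ.* + suc n ≡ i ℤ.+ i ℤ.* + n
    *-suc i n = ≡.trans (≡.cong (ℤ._*_ i) (ℤ.pos-+ 1 n)) (*-1+ i (+ n))
      where
      *-1+ : ∀ i m → i ℤ.* (ℤ.1ℤ ℤ.+ m) ≡ i ℤ.+ i ℤ.* m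
      *-1+ = ℤ-Solver.solve-∀

  sumTo-cong : ∀ n {f g : ℕ → Carrier} → (∀ i → i ℕ.≤ n → f i ≈ g i) → sumTo n f ≈ sumTo n g
  sumTo-cong zero    f≈g = f≈g 0 ℕ.z≤n
  sumTo-cong (suc n) f≈g = +-cong (sumTo-cong n (λ i i≤n → f≈g i (ℕ.m≤n⇒m≤1+n i≤n))) (f≈g (suc n) ℕ.≤-refl)

  sumTo-+ : ∀ n (f g : ℕ → Carrier) → sumTo n (λ i → f i + g i) ≈ sumTo n f + sumTo n g
  sumTo-+ zero    f g = refl
  sumTo-+ (suc n) f g = trans (+-congʳ (sumTo-+ n f g)) (interchange _ _ _ _)

  *-sumTo : ∀ n a (f : ℕ → Carrier) → a * sumTo n f ≈ sumTo n (λ i → a * f i)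
  *-sumTo zero    a f = refl
  *-sumTo (suc n) a f = trans (distribˡ _ _ _) (+-congʳ (*-sumTo n a f))

  sumTo-suc : ∀ n (f : ℕ → Carrier) → sumTo (suc n) f ≈ f 0 + sumTo n (λ i → f (suc i))
  sumTo-suc zero    f = refl
  sumTo-suc (suc n) f = trans (+-congʳ (sumTo-suc n f)) (+-assoc _ _ _)

  sumTo-reverse : ∀ n (f : ℕ → Carrier) → sumTo n (λ i → f (n ∸ i)) ≈ sumTo n f
  sumTo-reverse zero    f = refl
  sumTo-reverse (suc n) f = begin
    sumTo n (λ i → f (suc n ∸ i)) + f (n ∸ n)
      ≈⟨ +-cong (sumTo-cong n (λ i i≤n → reflexive (≡.cong f (ℕ.+-∸-assoc 1 i≤n))))
                (reflexive (≡.cong f (ℕ.n∸n≡0 n))) ⟩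
    sumTo n (λ i → f (suc (n ∸ i))) + f 0    ≈⟨ +-congʳ (sumTo-reverse n (λ i → f (suc i))) ⟩
    sumTo n (λ i → f (suc i)) + f 0          ≈⟨ +-comm _ _ ⟩
    f 0 + sumTo n (λ i → f (suc i))          ≈⟨ sumTo-suc n f ⟨
    sumTo (suc n) f                          ∎

  sum≈sumTo : ∀ n (f : Fin (suc n) → Carrier) (g : ℕ → Carrier) → (∀ k → f k ≈ g (toℕ k)) → sum f ≈ sumTo n g
  sum≈sumTo zero    f g f≈g = trans (+-identityʳ _) (f≈g Fin.zero)
  sum≈sumTo (suc n) f g f≈g =
    trans (+-cong (f≈g Fin.zero) (sum≈sumTo n (λ k → f (Fin.suc k)) (λ i → g (suc i)) (λ k → f≈g (Fin.suc k))))
          (sym (sumTo-suc n g))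

  binomial : ∀ n x y → pow (x + y) n ≈ sumTo n (λ i → natR (n C i) * (pow x (n ∸ i) * pow y i))
  binomial n x y = begin
    pow (x + y) n                      ≈⟨ pow-congˡ n (+-comm x y) ⟩
    pow (y + x) n                      ≡⟨ pow≡^ (y + x) n ⟩
    (y + x) ^ n                        ≈⟨ Binomial.theorem n y x ⟩
    Binomial.binomialExpansion y x n   ≈⟨ sum≈sumTo n _ _ term≈ ⟩
    sumTo n (λ i → natR (n C i) * (pow x (n ∸ i) * pow y i)) ∎
    where
    ×ᵣ≈natR* : ∀ m a → m ×ᵣ a ≈ natR m * a
    ×ᵣ≈natR* m a rewrite natR≡× m = trans (×-congʳ m (sym (*-identityˡ a))) (sym (×-assoc-* m 1# a))
    term≈ : ∀ k → (n C toℕ k) ×ᵣ (y ^ toℕ k * x ^ (n ∸ toℕ k)) ≈ natR (n C toℕ k) * (pow x (n ∸ toℕ k) * pow y (toℕ k))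
    term≈ k rewrite pow≡^ x (n ∸ toℕ k) | pow≡^ y (toℕ k) = trans (×ᵣ≈natR* (n C toℕ k) _) (*-congˡ (*-comm _ _))

  LinRec : Carrier → Carrier → Series → Set ℓ
  LinRec S W f = ∀ j → f (suc (suc j)) ≈ S * f (suc j) - W * f j

  LinRec-unique : ∀ {S W f g} → LinRec S W f → LinRec S W g → f 0 ≈ g 0 → f 1 ≈ g 1 → f ≈ₛ g
  LinRec-unique {S} {W} {f} {g} f-rec g-rec f0≈g0 f1≈g1 j = proj₁ (consecutive j)
    where
    consecutive : ∀ j → f j ≈ g j × f (suc j) ≈ g (suc j)
    consecutive zero    = f0≈g0 , f1≈g1
    consecutive (suc j) with consecutive j
    ... | fj≈gj , fj+1≈gj+1 =
      fj+1≈gj+1 , trans (f-rec j) (trans (+-cong (*-congˡ fj+1≈gj+1) (-‿cong (*-congˡ fj≈gj))) (sym (g-rec j)))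

  LinRec-combination : ∀ {S W f g} a b → LinRec S W f → LinRec S W g → LinRec S W (λ j → a * f j + b * g j)
  LinRec-combination {S} {W} {f} {g} a b f-rec g-rec j = begin
    a * f (2 ℕ.+ j) + b * g (2 ℕ.+ j)
      ≈⟨ +-cong (*-congˡ (f-rec j)) (*-congˡ (g-rec j)) ⟩
    a * (S * f (1 ℕ.+ j) - W * f j) + b * (S * g (1 ℕ.+ j) - W * g j)
      ≈⟨ solve 8 (λ a b S W f₁ f₀ g₁ g₀ → a :* (S :* f₁ :- W :* f₀) :+ b :* (S :* g₁ :- W :* g₀)
                                        := S :* (a :* f₁ :+ b :* g₁) :- W :* (a :* f₀ :+ b :* g₀))
               refl a b S W _ _ _ _ ⟩
    S * (a * f (1 ℕ.+ j) + b * g (1 ℕ.+ j)) - W * (a * f j + b * g j) ∎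

  geometric₂-LinRec : ∀ X Y x y → LinRec (x + y) (x * y) (λ j → X * pow x j + Y * pow y j)
  geometric₂-LinRec X Y x y j =
    solve 6 (λ X Y x y a b → X :* (x :* (x :* a)) :+ Y :* (y :* (y :* b))
                           := (x :+ y) :* (X :* (x :* a) :+ Y :* (y :* b)) :- (x :* y) :* (X :* a :+ Y :* b))
          refl X Y x y (pow x j) (pow y j)

  delay : Series → Series
  delay f zero    = 0#
  delay f (suc j) = f j

  delay-LinRec : ∀ {S W f} → f 1 ≈ S * f 0 → LinRec S W f → LinRec S W (delay f)
  delay-LinRec {S} {W} {f} f1≈Sf0 f-rec zero =
    trans f1≈Sf0 (sym (trans (+-congˡ (trans (-‿cong (zeroʳ W)) -0#≈0#)) (+-identityʳ _)))
  delay-LinRec f1≈Sf0 f-rec (suc j) = f-rec j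

  dotFrom-quad-≥3 : ∀ a b d k xs → dotFrom (quad a b d) (3 ℕ.+ k) xs ≈ 0#
  dotFrom-quad-≥3 a b d k []       = refl
  dotFrom-quad-≥3 a b d k (x ∷ xs) = trans (+-cong (zeroˡ x) (dotFrom-quad-≥3 a b d (suc k) xs)) (+-identityˡ 0#)

  module _ {t w S W : Carrier} (t≈-S : t ≈ - S) (w≈W : w ≈ W) where
    private
      D g : Series
      D = quad 1# t w
      g = inv1 D

    dotFrom-quad-2 : ∀ n → dotFrom D 2 (revInv D n) ≈ w * g n
    dotFrom-quad-2 zero    = +-identityʳ _
    dotFrom-quad-2 (suc n) = trans (+-congˡ (dotFrom-quad-≥3 1# t w 0 (revInv D n))) (+-identityʳ _)

    inv1-quad-1 : g 1 ≈ S * g 0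
    inv1-quad-1 = begin
      - (t * 1# + 0#)    ≈⟨ -‿cong (trans (+-identityʳ _) (*-congʳ t≈-S)) ⟩
      - (- S * 1#)       ≈⟨ trans (-‿cong (sym (-‿distribˡ-* S 1#))) (-‿involutive _) ⟩
      S * 1#             ∎

    inv1-quad-LinRec : LinRec S W g
    inv1-quad-LinRec n = begin
      - (t * g (suc n) + dotFrom D 2 (revInv D n))   ≈⟨ -‿cong (+-cong (*-congʳ t≈-S) (trans (dotFrom-quad-2 n) (*-congʳ w≈W))) ⟩
      - (- S * g (suc n) + W * g n)                  ≈⟨ solve 4 (λ S W a b → :- (:- S :* a :+ W :* b) := S :* a :- W :* b) refl S W _ _ ⟩
      S * g (suc n) - W * g n                        ∎

  sumTo-two : ∀ n (f : ℕ → Carrier) → (∀ k → f (2 ℕ.+ k) ≈ 0#) → sumTo (suc n) f ≈ f 0 + f 1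
  sumTo-two zero    f f≥2≈0 = refl
  sumTo-two (suc n) f f≥2≈0 = trans (+-cong (sumTo-two n f f≥2≈0) (f≥2≈0 n)) (+-identityʳ _)

  quad⊘ : ∀ A B D → (quad A B 0# ⊘ D) ≈ₛ (λ j → A * inv1 D j + B * delay (inv1 D) j)
  quad⊘ A B D zero    = sym (trans (+-congˡ (zeroʳ B)) (+-identityʳ _))
  quad⊘ A B D (suc j) = sumTo-two j _ vanishes
    where
    vanishes : ∀ k → quad A B 0# (2 ℕ.+ k) * inv1 D (suc j ∸ (2 ℕ.+ k)) ≈ 0#
    vanishes zero    = zeroˡ _
    vanishes (suc k) = zeroˡ _

  partial-fractions : ∀ {A B t w} X Y x y → A ≈ X + Y → B ≈ - (X * y + Y * x) → t ≈ - (x + y) → w ≈ x * y →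
                     (quad A B 0# ⊘ quad 1# t w) ≈ₛ (λ j → X * pow x j + Y * pow y j)
  partial-fractions {A} {B} {t} {w} X Y x y A≈ B≈ t≈ w≈ j =
    trans (quad⊘ A B (quad 1# t w) j) (LinRec-unique lhs-rec (geometric₂-LinRec X Y x y) at-0 at-1 j)
    where
    g : Series
    g = inv1 (quad 1# t w)
    lhs-rec : LinRec (x + y) (x * y) (λ j → A * g j + B * delay g j)
    lhs-rec = LinRec-combination A B (inv1-quad-LinRec t≈ w≈) (delay-LinRec (inv1-quad-1 t≈ w≈) (inv1-quad-LinRec t≈ w≈))
    at-0 : A * 1# + B * 0# ≈ X * 1# + Y * 1#
    at-0 = trans (+-congˡ (zeroʳ B)) (trans (+-identityʳ _) (trans (*-congʳ A≈) (distribʳ 1# X Y)))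
    at-1 : A * g 1 + B * 1# ≈ X * (x * 1#) + Y * (y * 1#)
    at-1 = begin
      A * g 1 + B * 1#        ≈⟨ +-cong (*-cong A≈ (inv1-quad-1 t≈ w≈)) (*-congʳ B≈) ⟩
      (X + Y) * ((x + y) * 1#) + - (X * y + Y * x) * 1#
        ≈⟨ solve 5 (λ X Y x y o → (X :+ Y) :* ((x :+ y) :* o) :+ :- (X :* y :+ Y :* x) :* o
                                := X :* (x :* o) :+ Y :* (y :* o)) refl X Y x y 1# ⟩
      X * (x * 1#) + Y * (y * 1#) ∎

  [-1]²≈1 : - 1# * - 1# ≈ 1#
  [-1]²≈1 = trans (-1*x≈-x (- 1#)) (-‿involutive 1#)

  [-1]²ⁿ≈1 : ∀ n → pow (- 1#) (2 ℕ.* n) ≈ 1#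
  [-1]²ⁿ≈1 n = trans (pow-double (- 1#) n) (trans (pow-congˡ n [-1]²≈1) (pow-1# n))

  [-1]²ⁿ⁺¹≈-1 : ∀ n → pow (- 1#) (suc (2 ℕ.* n)) ≈ - 1#
  [-1]²ⁿ⁺¹≈-1 n = trans (*-congˡ ([-1]²ⁿ≈1 n)) (*-identityʳ _)

  scale-pow : ∀ {a b c W N} → a * pow b N ≈ c → natR 2 * a * pow (b * W) N ≈ natR 2 * c * pow W N
  scale-pow {a} {b} {c} {W} {N} a*bᴺ≈c = begin
    natR 2 * a * pow (b * W) N            ≈⟨ *-congˡ (pow-* b W N) ⟩
    natR 2 * a * (pow b N * pow W N)      ≈⟨ solve 4 (λ t a x w → t :* a :* (x :* w) := t :* (a :* x) :* w) refl (natR 2) a _ _ ⟩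
    natR 2 * (a * pow b N) * pow W N      ≈⟨ *-congʳ (*-congˡ a*bᴺ≈c) ⟩
    natR 2 * c * pow W N                  ∎

  quadratic-splits : IsAlgClosedFieldChar0 → ∀ p q → ∃₂ λ α β → α * β ≈ q × α + β ≈ p
  quadratic-splits alg p q = α , p - α , αβ≈q , solve 2 (λ α p → α :+ (p :- α) := p) refl α p
    where
    open IsAlgClosedFieldChar0 alg
    root : ∃ λ x → evalPoly (q ∷ - p ∷ 1# ∷ []) x ≈ 0#
    root = algClosed (q ∷ - p ∷ []) (s≤s ℕ.z≤n)
    α : Carrier
    α = proj₁ root
    q+α[-p+α]≈0 : q + α * (- p + α) ≈ 0#
    q+α[-p+α]≈0 = trans (+-congˡ (*-congˡ (+-congˡ (sym α[1+α0]≈α)))) (proj₂ root)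
      where
      α[1+α0]≈α : α * (1# + α * 0#) ≈ α
      α[1+α0]≈α = trans (*-congˡ (trans (+-congˡ (zeroʳ α)) (+-identityʳ 1#))) (*-identityʳ α)
    αβ≈q : α * (p - α) ≈ q
    αβ≈q = begin
      α * (p - α)                           ≈⟨ +-identityʳ _ ⟨
      α * (p - α) + 0#                      ≈⟨ +-congˡ q+α[-p+α]≈0 ⟨
      α * (p - α) + (q + α * (- p + α))     ≈⟨ solve 3 (λ α p q → α :* (p :- α) :+ (q :+ α :* (:- p :+ α)) := q) refl α p q ⟩
      q                                     ∎

  module Roots (p q q⁻¹ α β : Carrier) (q*q⁻¹≈1 : q * q⁻¹ ≈ 1#) (αβ≈q : α * β ≈ q) (α+β≈p : α + β ≈ p) where

    α⁻¹ β⁻¹ : Carrier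
    α⁻¹ = β * q⁻¹
    β⁻¹ = α * q⁻¹

    α*α⁻¹≈1 : α * α⁻¹ ≈ 1#
    α*α⁻¹≈1 = trans (sym (*-assoc α β q⁻¹)) (trans (*-congʳ αβ≈q) q*q⁻¹≈1)

    β*β⁻¹≈1 : β * β⁻¹ ≈ 1#
    β*β⁻¹≈1 = trans (sym (*-assoc β α q⁻¹)) (trans (*-congʳ (trans (*-comm β α) αβ≈q)) q*q⁻¹≈1)

    α^ β^ Q : ℤ → Carrier
    α^ = zpow α α⁻¹
    β^ = zpow β β⁻¹
    Q  = zpow q q⁻¹

    Q≈α^*β^ : ∀ e → Q e ≈ α^ e * β^ e
    Q≈α^*β^ e = trans (zpow-cong e (sym αβ≈q) q⁻¹≈α⁻¹*β⁻¹) (zpow-* α α⁻¹ β β⁻¹ e)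
      where
      q⁻¹≈α⁻¹*β⁻¹ : q⁻¹ ≈ α⁻¹ * β⁻¹
      q⁻¹≈α⁻¹*β⁻¹ = begin
        q⁻¹                          ≈⟨ *-identityˡ _ ⟨
        1# * q⁻¹                     ≈⟨ *-congʳ (trans (*-congʳ αβ≈q) q*q⁻¹≈1) ⟨
        ((α * β) * q⁻¹) * q⁻¹        ≈⟨ solve 3 (λ a b c → ((a :* b) :* c) :* c := (b :* c) :* (a :* c)) refl α β q⁻¹ ⟩
        α⁻¹ * β⁻¹                    ∎

    module _ {x₀ x₁ a b : Carrier} (x₀≈ : x₀ ≈ a + b) (x₁≈ : x₁ ≈ a * α + b * β) where

      fwd-binet : ∀ n → proj₁ (fwd p q x₀ x₁ n) ≈ a * pow α n + b * pow β n
                      × proj₂ (fwd p q x₀ x₁ n) ≈ a * pow α (suc n) + b * pow β (suc n)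
      fwd-binet zero =
        trans x₀≈ (sym (+-cong (*-identityʳ a) (*-identityʳ b))) ,
        trans x₁≈ (sym (+-cong (*-congˡ (*-identityʳ α)) (*-congˡ (*-identityʳ β))))
      fwd-binet (suc n) with fwd-binet n
      ... | xₙ≈ , xₙ₊₁≈ = xₙ₊₁≈ , (begin
        p * proj₂ (fwd p q x₀ x₁ n) - q * proj₁ (fwd p q x₀ x₁ n)
          ≈⟨ +-cong (*-cong (sym α+β≈p) xₙ₊₁≈) (-‿cong (*-cong (sym αβ≈q) xₙ≈)) ⟩
        (α + β) * (a * (α * pow α n) + b * (β * pow β n)) - (α * β) * (a * pow α n + b * pow β n)
          ≈⟨ solve 6 (λ α β a b A B → (α :+ β) :* (a :* (α :* A) :+ b :* (β :* B)) :- (α :* β) :* (a :* A :+ b :* B)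
                                   := a :* (α :* (α :* A)) :+ b :* (β :* (β :* B))) refl α β a b (pow α n) (pow β n) ⟩
        a * pow α (2 ℕ.+ n) + b * pow β (2 ℕ.+ n) ∎)

      bwd-binet : ∀ n → proj₁ (bwd p q⁻¹ x₀ x₁ n) ≈ a * pow α⁻¹ n + b * pow β⁻¹ n
                      × proj₂ (bwd p q⁻¹ x₀ x₁ n) ≈ a * (α * pow α⁻¹ n) + b * (β * pow β⁻¹ n)
      bwd-binet zero =
        trans x₀≈ (sym (+-cong (*-identityʳ a) (*-identityʳ b))) ,
        trans x₁≈ (sym (+-cong (*-congˡ (*-identityʳ α)) (*-congˡ (*-identityʳ β))))
      bwd-binet (suc n) with bwd-binet n
      ... | x₋ₙ≈ , x₁₋ₙ≈ = (begin
        q⁻¹ * (p * proj₁ (bwd p q⁻¹ x₀ x₁ n) - proj₂ (bwd p q⁻¹ x₀ x₁ n))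
          ≈⟨ *-congˡ (+-cong (*-cong (sym α+β≈p) x₋ₙ≈) (-‿cong x₁₋ₙ≈)) ⟩
        q⁻¹ * ((α + β) * (a * pow α⁻¹ n + b * pow β⁻¹ n) - (a * (α * pow α⁻¹ n) + b * (β * pow β⁻¹ n)))
          ≈⟨ solve 7 (λ c α β a b A B → c :* ((α :+ β) :* (a :* A :+ b :* B) :- (a :* (α :* A) :+ b :* (β :* B)))
                                     := a :* ((β :* c) :* A) :+ b :* ((α :* c) :* B)) refl q⁻¹ α β a b _ _ ⟩
        a * pow α⁻¹ (suc n) + b * pow β⁻¹ (suc n) ∎) ,
        trans x₋ₙ≈ (+-cong (*-congˡ (cancel α*α⁻¹≈1)) (*-congˡ (cancel β*β⁻¹≈1)))
        where
        cancel : ∀ {z z⁻¹ A} → z * z⁻¹ ≈ 1# → A ≈ z * (z⁻¹ * A)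
        cancel z*z⁻¹≈1 = sym (trans (sym (*-assoc _ _ _)) (trans (*-congʳ z*z⁻¹≈1) (*-identityˡ _)))

      lucasSeq-binet : ∀ e → lucasSeq p q q⁻¹ x₀ x₁ e ≈ a * α^ e + b * β^ e
      lucasSeq-binet (+ n)    = proj₁ (fwd-binet n)
      lucasSeq-binet -[1+ n ] = proj₁ (bwd-binet (suc n))

    V-binet : ∀ e → V p q q⁻¹ e ≈ α^ e + β^ e
    V-binet e = trans (lucasSeq-binet refl (trans (sym α+β≈p) (sym (+-cong (*-identityˡ α) (*-identityˡ β)))) e)
                      (+-cong (*-identityˡ _) (*-identityˡ _))

    U-binet : ∀ {δ} → (α - β) * δ ≈ 1# → ∀ e → U p q q⁻¹ e ≈ δ * (α^ e + - 1# * β^ e)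
    U-binet {δ} [α-β]δ≈1 e = begin
      U p q q⁻¹ e                   ≈⟨ lucasSeq-binet (sym (-‿inverseʳ δ)) 1≈δα-δβ e ⟩
      δ * α^ e + - δ * β^ e         ≈⟨ solve 3 (λ d a b → d :* a :+ (:- d) :* b := d :* (a :+ :- b)) refl δ (α^ e) (β^ e) ⟩
      δ * (α^ e + - β^ e)           ≈⟨ *-congˡ (+-congˡ (-1*x≈-x _)) ⟨
      δ * (α^ e + - 1# * β^ e)      ∎
      where
      1≈δα-δβ : 1# ≈ δ * α + - δ * β
      1≈δα-δβ = trans (sym [α-β]δ≈1) (solve 3 (λ α β d → (α :- β) :* d := d :* α :+ (:- d) :* β) refl α β δ)

    -- Opaque so that unification can read the exponents off a term mono a b.
    opaque
      mono : ℤ → ℤ → Carrier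
      mono a b = α^ a * β^ b

      mono-* : ∀ a b a′ b′ → mono a b * mono a′ b′ ≈ mono (a ℤ.+ a′) (b ℤ.+ b′)
      mono-* a b a′ b′ = begin
        (α^ a * β^ b) * (α^ a′ * β^ b′)   ≈⟨ solve 4 (λ a b c d → (a :* b) :* (c :* d) := (a :* c) :* (b :* d)) refl _ _ _ _ ⟩
        (α^ a * α^ a′) * (β^ b * β^ b′)   ≈⟨ *-cong (zpow-+ α*α⁻¹≈1 a a′) (zpow-+ β*β⁻¹≈1 b b′) ⟨
        α^ (a ℤ.+ a′) * β^ (b ℤ.+ b′)     ∎

      mono-pow : ∀ a b n → pow (mono a b) n ≈ mono (a ℤ.* + n) (b ℤ.* + n)
      mono-pow a b n = trans (pow-* (α^ a) (β^ b) n) (sym (*-cong (zpow-pow α*α⁻¹≈1 a n) (zpow-pow β*β⁻¹≈1 b n)))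

      α^*β^≈mono : ∀ a b → α^ a * β^ b ≈ mono a b
      α^*β^≈mono a b = refl

      α^≈mono : ∀ a → α^ a ≈ mono a (+ 0)
      α^≈mono a = sym (*-identityʳ _)

      β^≈mono : ∀ b → β^ b ≈ mono (+ 0) b
      β^≈mono b = sym (*-identityˡ _)

      Q≈mono : ∀ e → Q e ≈ mono e e
      Q≈mono = Q≈α^*β^

    mono-cong : ∀ {a a′ b b′} → a ≡ a′ → b ≡ b′ → mono a b ≈ mono a′ b′
    mono-cong ≡.refl ≡.refl = refl

    -- The identities for vⁿ, u²ⁿ and u²ⁿ⁻¹ are the cases (σ, ε, d, N) = (1, 1, 1, n), (−1, 1, 1, 2n)
    -- and (−1, −1, (α − β)⁻¹, 2n − 1).
    module Expansion (σ ε d : Carrier) (σ²≈1 : σ * σ ≈ 1#) (N : ℕ) (σᴺ≈ε : pow σ N ≈ ε) (r s : ℤ) where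

      k : ℕ → ℤ
      k j = r ℤ.* + j ℤ.+ s

      m : ℕ → ℤ
      m i = + N ℤ.- + (2 ℕ.* i)

      x y X Y coeff : ℕ → Carrier
      x i = mono (r ℤ.* (+ N ℤ.- + i)) (r ℤ.* + i)
      y i = mono (r ℤ.* + i) (r ℤ.* (+ N ℤ.- + i))
      X i = d * α^ (s ℤ.* m i)
      Y i = ε * d * β^ (s ℤ.* m i)
      coeff i = pow σ i * natR (N C i) * Q (s ℤ.* + i)

      term : ℕ → ℕ → Carrier
      term j i = natR (N C i) * (pow σ i * mono (k j ℤ.* + (N ∸ i)) (k j ℤ.* + i))

      m≡ : ∀ i → m i ≡ + N ℤ.- + 2 ℤ.* + i
      m≡ i = ≡.cong (ℤ._-_ (+ N)) (ℤ.pos-* 2 i)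

      ε²≈1 : ε * ε ≈ 1#
      ε²≈1 = trans (*-cong (sym σᴺ≈ε) (sym σᴺ≈ε)) (pow-inverse N σ²≈1)

      σ-complement : ∀ {i} → i ℕ.≤ N → ε * pow σ i ≈ pow σ (N ∸ i)
      σ-complement {i} i≤N = begin
        ε * pow σ i                          ≈⟨ *-congʳ σᴺ≈ε ⟨
        pow σ N * pow σ i                    ≡⟨ ≡.cong (λ n → pow σ n * pow σ i) (ℕ.m∸n+n≡m i≤N) ⟨
        pow σ (N ∸ i ℕ.+ i) * pow σ i        ≈⟨ *-congʳ (pow-+ σ (N ∸ i) i) ⟩
        (pow σ (N ∸ i) * pow σ i) * pow σ i  ≈⟨ *-assoc _ _ _ ⟩
        pow σ (N ∸ i) * (pow σ i * pow σ i)  ≈⟨ *-congˡ (pow-inverse i σ²≈1) ⟩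
        pow σ (N ∸ i) * 1#                   ≈⟨ *-identityʳ _ ⟩
        pow σ (N ∸ i)                        ∎

      binomial-terms : ∀ j → pow (α^ (k j) + σ * β^ (k j)) N ≈ sumTo N (term j)
      binomial-terms j = trans (binomial N _ _) (sumTo-cong N (λ i _ → *-congˡ (begin
        pow (α^ (k j)) (N ∸ i) * pow (σ * β^ (k j)) i
          ≈⟨ *-cong (sym (zpow-pow α*α⁻¹≈1 (k j) (N ∸ i))) (pow-* σ (β^ (k j)) i) ⟩
        α^ (k j ℤ.* + (N ∸ i)) * (pow σ i * pow (β^ (k j)) i)
          ≈⟨ *-congˡ (*-congˡ (zpow-pow β*β⁻¹≈1 (k j) i)) ⟨
        α^ (k j ℤ.* + (N ∸ i)) * (pow σ i * β^ (k j ℤ.* + i))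
          ≈⟨ solve 3 (λ a b c → a :* (b :* c) := b :* (a :* c)) refl _ _ _ ⟩
        pow σ i * (α^ (k j ℤ.* + (N ∸ i)) * β^ (k j ℤ.* + i))
          ≈⟨ *-congˡ (α^*β^≈mono _ _) ⟩
        pow σ i * mono (k j ℤ.* + (N ∸ i)) (k j ℤ.* + i) ∎)))

      exponent≡k*[N∸i] : ∀ j i → i ℕ.≤ N →
                     s ℤ.* + i ℤ.+ s ℤ.* m i ℤ.+ r ℤ.* (+ N ℤ.- + i) ℤ.* + j ≡ k j ℤ.* + (N ∸ i)
      exponent≡k*[N∸i] j i i≤N =
        ≡.trans (≡.cong (λ t → s ℤ.* + i ℤ.+ s ℤ.* t ℤ.+ r ℤ.* (+ N ℤ.- + i) ℤ.* + j) (m≡ i))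
                (≡.trans (identity r s (+ N) (+ i) (+ j)) (≡.cong (ℤ._*_ (k j)) (≡.sym (pos-∸ i≤N))))
        where
        identity : ∀ r s N i j → s ℤ.* i ℤ.+ s ℤ.* (N ℤ.- + 2 ℤ.* i) ℤ.+ r ℤ.* (N ℤ.- i) ℤ.* j
                                 ≡ (r ℤ.* j ℤ.+ s) ℤ.* (N ℤ.- i)
        identity = ℤ-Solver.solve-∀

      exponent≡k*i : ∀ j i → s ℤ.* + i ℤ.+ + 0 ℤ.+ r ℤ.* + i ℤ.* + j ≡ k j ℤ.* + i
      exponent≡k*i j i = identity r s (+ i) (+ j)
        where
        identity : ∀ r s i j → s ℤ.* i ℤ.+ + 0 ℤ.+ r ℤ.* i ℤ.* j ≡ (r ℤ.* j ℤ.+ s) ℤ.* i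
        identity = ℤ-Solver.solve-∀

      monomial-X : ∀ j i → i ℕ.≤ N →
                  (Q (s ℤ.* + i) * α^ (s ℤ.* m i)) * pow (x i) j ≈ mono (k j ℤ.* + (N ∸ i)) (k j ℤ.* + i)
      monomial-X j i i≤N = begin
        (Q (s ℤ.* + i) * α^ (s ℤ.* m i)) * pow (x i) j
          ≈⟨ *-cong (*-cong (Q≈mono _) (α^≈mono _)) (mono-pow _ _ j) ⟩
        (mono (s ℤ.* + i) (s ℤ.* + i) * mono (s ℤ.* m i) (+ 0)) * mono (r ℤ.* (+ N ℤ.- + i) ℤ.* + j) (r ℤ.* + i ℤ.* + j)
          ≈⟨ trans (*-congʳ (mono-* _ _ _ _)) (mono-* _ _ _ _) ⟩
        mono (s ℤ.* + i ℤ.+ s ℤ.* m i ℤ.+ r ℤ.* (+ N ℤ.- + i) ℤ.* + j) (s ℤ.* + i ℤ.+ + 0 ℤ.+ r ℤ.* + i ℤ.* + j)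
          ≈⟨ mono-cong (exponent≡k*[N∸i] j i i≤N) (exponent≡k*i j i) ⟩
        mono (k j ℤ.* + (N ∸ i)) (k j ℤ.* + i) ∎

      monomial-Y : ∀ j i → i ℕ.≤ N →
                  (Q (s ℤ.* + i) * β^ (s ℤ.* m i)) * pow (y i) j ≈ mono (k j ℤ.* + (N ∸ (N ∸ i))) (k j ℤ.* + (N ∸ i))
      monomial-Y j i i≤N = begin
        (Q (s ℤ.* + i) * β^ (s ℤ.* m i)) * pow (y i) j
          ≈⟨ *-cong (*-cong (Q≈mono _) (β^≈mono _)) (mono-pow _ _ j) ⟩
        (mono (s ℤ.* + i) (s ℤ.* + i) * mono (+ 0) (s ℤ.* m i)) * mono (r ℤ.* + i ℤ.* + j) (r ℤ.* (+ N ℤ.- + i) ℤ.* + j)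
          ≈⟨ trans (*-congʳ (mono-* _ _ _ _)) (mono-* _ _ _ _) ⟩
        mono (s ℤ.* + i ℤ.+ + 0 ℤ.+ r ℤ.* + i ℤ.* + j) (s ℤ.* + i ℤ.+ s ℤ.* m i ℤ.+ r ℤ.* (+ N ℤ.- + i) ℤ.* + j)
          ≈⟨ mono-cong (≡.trans (exponent≡k*i j i) (≡.cong (λ n → k j ℤ.* + n) (≡.sym (ℕ.m∸[m∸n]≡n i≤N))))
                       (exponent≡k*[N∸i] j i i≤N) ⟩
        mono (k j ℤ.* + (N ∸ (N ∸ i))) (k j ℤ.* + (N ∸ i)) ∎

      term-X : ∀ j i → i ℕ.≤ N → coeff i * (X i * pow (x i) j) ≈ d * term j i
      term-X j i i≤N = begin
        (pow σ i * natR (N C i) * Q (s ℤ.* + i)) * ((d * α^ (s ℤ.* m i)) * pow (x i) j)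
          ≈⟨ solve 6 (λ σⁱ C q d a b → (σⁱ :* C :* q) :* ((d :* a) :* b) := d :* (C :* (σⁱ :* ((q :* a) :* b))))
                     refl (pow σ i) (natR (N C i)) _ d _ _ ⟩
        d * (natR (N C i) * (pow σ i * ((Q (s ℤ.* + i) * α^ (s ℤ.* m i)) * pow (x i) j)))
          ≈⟨ *-congˡ (*-congˡ (*-congˡ (monomial-X j i i≤N))) ⟩
        d * term j i ∎

      term-Y : ∀ j i → i ℕ.≤ N → coeff i * (Y i * pow (y i) j) ≈ d * term j (N ∸ i)
      term-Y j i i≤N = begin
        (pow σ i * natR (N C i) * Q (s ℤ.* + i)) * ((ε * d * β^ (s ℤ.* m i)) * pow (y i) j)
          ≈⟨ solve 7 (λ σⁱ C q ε d b c → (σⁱ :* C :* q) :* ((ε :* d :* b) :* c) := d :* (C :* ((ε :* σⁱ) :* ((q :* b) :* c))))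
                     refl (pow σ i) (natR (N C i)) _ ε d _ _ ⟩
        d * (natR (N C i) * ((ε * pow σ i) * ((Q (s ℤ.* + i) * β^ (s ℤ.* m i)) * pow (y i) j)))
          ≈⟨ *-congˡ (*-cong (reflexive (≡.cong natR (nCk≡nC[n∸k] i≤N)))
                             (*-cong (σ-complement i≤N) (monomial-Y j i i≤N))) ⟩
        d * term j (N ∸ i) ∎

      symmetrised-binomial : ∀ j → natR 2 * d * pow (α^ (k j) + σ * β^ (k j)) N
                                  ≈ sumTo N (λ i → coeff i * (X i * pow (x i) j + Y i * pow (y i) j))
      symmetrised-binomial j = sym (begin
        sumTo N (λ i → coeff i * (X i * pow (x i) j + Y i * pow (y i) j))
          ≈⟨ sumTo-cong N (λ i i≤N → trans (distribˡ _ _ _) (+-cong (term-X j i i≤N) (term-Y j i i≤N))) ⟩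
        sumTo N (λ i → d * term j i + d * term j (N ∸ i))
          ≈⟨ sumTo-+ N _ _ ⟩
        sumTo N (λ i → d * term j i) + sumTo N (λ i → d * term j (N ∸ i))
          ≈⟨ +-congˡ (sumTo-reverse N (λ i → d * term j i)) ⟩
        sumTo N (λ i → d * term j i) + sumTo N (λ i → d * term j i)
          ≈⟨ +-cong (*-sumTo N d (term j)) (*-sumTo N d (term j)) ⟨
        d * sumTo N (term j) + d * sumTo N (term j)
          ≈⟨ solve 2 (λ d T → d :* T :+ d :* T := con (+ 2) :* d :* T) refl d _ ⟩
        natR 2 * d * sumTo N (term j)
          ≈⟨ *-congˡ (binomial-terms j) ⟨
        natR 2 * d * pow (α^ (k j) + σ * β^ (k j)) N ∎)

      x*y≈Q : ∀ i → x i * y i ≈ Q (r ℤ.* + N)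
      x*y≈Q i = begin
        x i * y i                                                  ≈⟨ mono-* _ _ _ _ ⟩
        mono (r ℤ.* (+ N ℤ.- + i) ℤ.+ r ℤ.* + i) (r ℤ.* + i ℤ.+ r ℤ.* (+ N ℤ.- + i))
          ≈⟨ mono-cong (identity r (+ N) (+ i)) (≡.trans (ℤ.+-comm (r ℤ.* + i) _) (identity r (+ N) (+ i))) ⟩
        mono (r ℤ.* + N) (r ℤ.* + N)                                ≈⟨ Q≈mono _ ⟨
        Q (r ℤ.* + N)                                               ∎
        where
        identity : ∀ r N i → r ℤ.* (N ℤ.- i) ℤ.+ r ℤ.* i ≡ r ℤ.* N
        identity = ℤ-Solver.solve-∀

      x+y≈Q*V : ∀ i → x i + y i ≈ Q (r ℤ.* + i) * V p q q⁻¹ (r ℤ.* m i)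
      x+y≈Q*V i = sym (begin
        Q (r ℤ.* + i) * V p q q⁻¹ (r ℤ.* m i)
          ≈⟨ *-cong (Q≈mono _) (trans (V-binet (r ℤ.* m i)) (+-cong (α^≈mono _) (β^≈mono _))) ⟩
        mono (r ℤ.* + i) (r ℤ.* + i) * (mono (r ℤ.* m i) (+ 0) + mono (+ 0) (r ℤ.* m i))
          ≈⟨ trans (distribˡ _ _ _) (+-cong (mono-* _ _ _ _) (mono-* _ _ _ _)) ⟩
        mono (r ℤ.* + i ℤ.+ r ℤ.* m i) (r ℤ.* + i ℤ.+ + 0) + mono (r ℤ.* + i ℤ.+ + 0) (r ℤ.* + i ℤ.+ r ℤ.* m i)
          ≈⟨ +-cong (mono-cong ri+rm≡ (ℤ.+-identityʳ _)) (mono-cong (ℤ.+-identityʳ _) ri+rm≡) ⟩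
        x i + y i ∎)
        where
        identity : ∀ r N i → r ℤ.* i ℤ.+ r ℤ.* (N ℤ.- + 2 ℤ.* i) ≡ r ℤ.* (N ℤ.- i)
        identity = ℤ-Solver.solve-∀
        ri+rm≡ : r ℤ.* + i ℤ.+ r ℤ.* m i ≡ r ℤ.* (+ N ℤ.- + i)
        ri+rm≡ = ≡.trans (≡.cong (λ t → r ℤ.* + i ℤ.+ r ℤ.* t) (m≡ i)) (identity r (+ N) (+ i))

      Xy+Yx≈ : ∀ i → let E = s ℤ.* m i ℤ.+ r ℤ.* + i ; t = (r ℤ.- s) ℤ.* m i in
               X i * y i + Y i * x i ≈ ε * (Q E * (d * (α^ t + ε * β^ t)))
      Xy+Yx≈ i = begin
        (d * α^ (s ℤ.* m i)) * y i + (ε * d * β^ (s ℤ.* m i)) * x i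
          ≈⟨ +-cong (trans (*-assoc _ _ _) (*-congˡ (*-congʳ (α^≈mono _))))
                    (trans (*-assoc _ _ _) (*-congˡ (*-congʳ (β^≈mono _)))) ⟩
        d * (mono (s ℤ.* m i) (+ 0) * y i) + ε * d * (mono (+ 0) (s ℤ.* m i) * x i)
          ≈⟨ +-cong (*-congˡ (mono-* _ _ _ _)) (*-congˡ (mono-* _ _ _ _)) ⟩
        d * mono E (+ 0 ℤ.+ r ℤ.* (+ N ℤ.- + i)) + ε * d * mono (+ 0 ℤ.+ r ℤ.* (+ N ℤ.- + i)) E
          ≈⟨ +-cong (*-congˡ (mono-cong (≡.sym (ℤ.+-identityʳ E)) E+t≡))
                    (*-congˡ (mono-cong E+t≡ (≡.sym (ℤ.+-identityʳ E)))) ⟩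
        d * mono (E ℤ.+ + 0) (E ℤ.+ t) + ε * d * mono (E ℤ.+ t) (E ℤ.+ + 0)
          ≈⟨ +-cong (*-congˡ (trans (sym (mono-* E E (+ 0) t)) (*-cong (sym (Q≈mono E)) (sym (β^≈mono t)))))
                    (*-congˡ (trans (sym (mono-* E E t (+ 0))) (*-cong (sym (Q≈mono E)) (sym (α^≈mono t))))) ⟩
        d * (Q E * β^ t) + ε * d * (Q E * α^ t)
          ≈⟨ +-congʳ (trans (*-congʳ ε²≈1) (*-identityˡ _)) ⟨
        (ε * ε) * (d * (Q E * β^ t)) + ε * d * (Q E * α^ t)
          ≈⟨ solve 5 (λ e d q a b → (e :* e) :* (d :* (q :* b)) :+ e :* d :* (q :* a) := e :* (q :* (d :* (a :+ e :* b))))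
                     refl ε d (Q E) (α^ t) (β^ t) ⟩
        ε * (Q E * (d * (α^ t + ε * β^ t))) ∎
        where
        E t : ℤ
        E = s ℤ.* m i ℤ.+ r ℤ.* + i
        t = (r ℤ.- s) ℤ.* m i
        identity : ∀ r s N i → + 0 ℤ.+ r ℤ.* (N ℤ.- i) ≡ (s ℤ.* (N ℤ.- + 2 ℤ.* i) ℤ.+ r ℤ.* i) ℤ.+ (r ℤ.- s) ℤ.* (N ℤ.- + 2 ℤ.* i)
        identity = ℤ-Solver.solve-∀
        E+t≡ : + 0 ℤ.+ r ℤ.* (+ N ℤ.- + i) ≡ E ℤ.+ t
        E+t≡ = ≡.trans (identity r s (+ N) (+ i)) (≡.cong (λ u → (s ℤ.* u ℤ.+ r ℤ.* + i) ℤ.+ (r ℤ.- s) ℤ.* u) (≡.sym (m≡ i)))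

      power-series : ∀ (w : ℤ → Carrier) {κ A B : ℕ → Carrier} {c₂ : Carrier} →
        (∀ e → w e ≈ d * (α^ e + ε * β^ e)) →
        (∀ i → κ i ≈ coeff i) →
        (∀ i → A i ≈ w (s ℤ.* m i)) →
        (∀ i → B i ≈ - (ε * (Q (s ℤ.* m i ℤ.+ r ℤ.* + i) * w ((r ℤ.- s) ℤ.* m i)))) →
        c₂ ≈ Q (r ℤ.* + N) →
        (λ j → natR 2 * d * pow (α^ (k j) + σ * β^ (k j)) N)
          ≈ₛ sumS N (λ i → κ i • (quad (A i) (B i) 0# ⊘ quad 1# (- (Q (r ℤ.* + i) * V p q q⁻¹ (r ℤ.* m i))) c₂))
      power-series w {κ} {A} {B} w≈ κ≈ A≈ B≈ c₂≈ j = trans (symmetrised-binomial j) (sumTo-cong N (λ i _ →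
        *-cong (sym (κ≈ i))
               (sym (partial-fractions (X i) (Y i) (x i) (y i) (A≈X+Y i) (B≈-[Xy+Yx] i)
                                      (-‿cong (sym (x+y≈Q*V i))) (trans c₂≈ (sym (x*y≈Q i))) j))))
        where
        A≈X+Y : ∀ i → A i ≈ X i + Y i
        A≈X+Y i = trans (A≈ i) (trans (w≈ _)
          (solve 4 (λ d e a b → d :* (a :+ e :* b) := d :* a :+ e :* d :* b) refl d ε _ _))
        B≈-[Xy+Yx] : ∀ i → B i ≈ - (X i * y i + Y i * x i)
        B≈-[Xy+Yx] i = trans (B≈ i) (-‿cong (sym (trans (Xy+Yx≈ i) (*-congˡ (*-congˡ (sym (w≈ _)))))))

    u v : ℤ → Carrier
    u = U p q q⁻¹
    v = V p q q⁻¹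

    Δ : Carrier
    Δ = p * p - natR 4 * q

    Δ≈[α-β]² : Δ ≈ (α - β) * (α - β)
    Δ≈[α-β]² = begin
      p * p - natR 4 * q                        ≈⟨ +-cong (*-cong (sym α+β≈p) (sym α+β≈p)) (-‿cong (*-congˡ (sym αβ≈q))) ⟩
      (α + β) * (α + β) - natR 4 * (α * β)      ≈⟨ solve 2 (λ α β → (α :+ β) :* (α :+ β) :- con (+ 4) :* (α :* β) := (α :- β) :* (α :- β)) refl α β ⟩
      (α - β) * (α - β)                         ∎

    α-β-invertible : IsAlgClosedFieldChar0 → ¬ (Δ ≈ 0#) → ∃ λ δ → (α - β) * δ ≈ 1#
    α-β-invertible alg Δ≉0 = inverses (α - β) (λ α-β≈0 → Δ≉0 (trans Δ≈[α-β]² (trans (*-congʳ α-β≈0) (zeroˡ _))))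
      where open IsAlgClosedFieldChar0 alg

    module _ {δ : Carrier} ([α-β]δ≈1 : (α - β) * δ ≈ 1#) where

      Δⁿδ²ⁿ≈1 : ∀ n → pow Δ n * pow δ (2 ℕ.* n) ≈ 1#
      Δⁿδ²ⁿ≈1 n = begin
        pow Δ n * pow δ (2 ℕ.* n)                     ≈⟨ *-cong (pow-congˡ n Δ≈[α-β]²) (pow-double δ n) ⟩
        pow ((α - β) * (α - β)) n * pow (δ * δ) n     ≈⟨ pow-inverse n D²δ²≈1 ⟩
        1#                                            ∎
        where
        D²δ²≈1 : ((α - β) * (α - β)) * (δ * δ) ≈ 1#
        D²δ²≈1 = begin
          ((α - β) * (α - β)) * (δ * δ)     ≈⟨ solve 2 (λ D δ → (D :* D) :* (δ :* δ) := (D :* δ) :* (D :* δ)) refl (α - β) δ ⟩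
          ((α - β) * δ) * ((α - β) * δ)     ≈⟨ *-cong [α-β]δ≈1 [α-β]δ≈1 ⟩
          1# * 1#                           ≈⟨ *-identityˡ 1# ⟩
          1#                                ∎

      even-powers-of-u : ∀ r s n →
        (λ j → natR 2 * pow Δ n * pow (u (r ℤ.* + j ℤ.+ s)) (2 ℕ.* n))
          ≈ₛ sumS (2 ℕ.* n) (λ i →
               (pow (- 1#) i * natR ((2 ℕ.* n) C i) * Q (s ℤ.* + i)) •
               (quad (v (s ℤ.* (+ (2 ℕ.* n) ℤ.- + (2 ℕ.* i))))
                     (- (Q (s ℤ.* (+ (2 ℕ.* n) ℤ.- + (2 ℕ.* i)) ℤ.+ r ℤ.* + i)
                         * v ((r ℤ.- s) ℤ.* (+ (2 ℕ.* n) ℤ.- + (2 ℕ.* i)))))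
                     0#
                ⊘ quad 1#
                       (- (Q (r ℤ.* + i) * v (r ℤ.* (+ (2 ℕ.* n) ℤ.- + (2 ℕ.* i)))))
                       (Q (+ 2 ℤ.* r ℤ.* + n))))
      even-powers-of-u r s n j =
        trans (trans (*-congˡ (pow-congˡ (2 ℕ.* n) (U-binet [α-β]δ≈1 (k j)))) (scale-pow {N = 2 ℕ.* n} (Δⁿδ²ⁿ≈1 n)))
              (power-series v v≈ (λ _ → refl) (λ _ → refl) (λ _ → -‿cong (sym (*-identityˡ _))) (reflexive (≡.cong Q 2rn≡)) j)
        where
        open Expansion (- 1#) 1# 1# [-1]²≈1 (2 ℕ.* n) ([-1]²ⁿ≈1 n) r s
        v≈ : ∀ e → v e ≈ 1# * (α^ e + 1# * β^ e)
        v≈ e = trans (V-binet e) (sym (trans (*-identityˡ _) (+-congˡ (*-identityˡ _))))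
        2rn≡ : + 2 ℤ.* r ℤ.* + n ≡ r ℤ.* + (2 ℕ.* n)
        2rn≡ = ≡.trans (identity r (+ n)) (≡.cong (ℤ._*_ r) (≡.sym (ℤ.pos-* 2 n)))
          where
          identity : ∀ r n → + 2 ℤ.* r ℤ.* n ≡ r ℤ.* (+ 2 ℤ.* n)
          identity = ℤ-Solver.solve-∀

      odd-powers-of-u : ∀ r s n → 1 ℕ.≤ n →
        (λ j → natR 2 * pow Δ (n ∸ 1) * pow (u (r ℤ.* + j ℤ.+ s)) (2 ℕ.* n ∸ 1))
          ≈ₛ sumS (2 ℕ.* n ∸ 1) (λ i →
               (pow (- 1#) i * natR ((2 ℕ.* n ∸ 1) C i) * Q (s ℤ.* + i)) •
               (quad (u (s ℤ.* (+ (2 ℕ.* n ∸ 1) ℤ.- + (2 ℕ.* i))))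
                     (Q (s ℤ.* (+ (2 ℕ.* n ∸ 1) ℤ.- + (2 ℕ.* i)) ℤ.+ r ℤ.* + i)
                       * u ((r ℤ.- s) ℤ.* (+ (2 ℕ.* n ∸ 1) ℤ.- + (2 ℕ.* i))))
                     0#
                ⊘ quad 1#
                       (- (Q (r ℤ.* + i) * v (r ℤ.* (+ (2 ℕ.* n ∸ 1) ℤ.- + (2 ℕ.* i)))))
                       (Q (+ (2 ℕ.* n ∸ 1) ℤ.* r))))
      odd-powers-of-u r s (suc n) _ j =
        trans (trans (*-congˡ (pow-congˡ N (u≈ (k j)))) (scale-pow {N = N} Δⁿδᴺ≈δ))
              (power-series u u≈ (λ _ → refl) (λ _ → refl) (λ _ → sym -[-1*x]≈x) (reflexive (≡.cong Q (ℤ.*-comm (+ N) r))) j)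
        where
        N : ℕ
        N = 2 ℕ.* suc n ∸ 1
        N≡ : N ≡ suc (2 ℕ.* n)
        N≡ = ≡.cong (_∸ 1) (ℕ.*-suc 2 n)
        [-1]ᴺ≈-1 : pow (- 1#) N ≈ - 1#
        [-1]ᴺ≈-1 = trans (reflexive (≡.cong (pow (- 1#)) N≡)) ([-1]²ⁿ⁺¹≈-1 n)
        open Expansion (- 1#) (- 1#) δ [-1]²≈1 N [-1]ᴺ≈-1 r s
        u≈ : ∀ e → u e ≈ δ * (α^ e + - 1# * β^ e)
        u≈ = U-binet [α-β]δ≈1
        -[-1*x]≈x : ∀ {x} → - (- 1# * x) ≈ x
        -[-1*x]≈x = trans (-‿cong (-1*x≈-x _)) (-‿involutive _)
        Δⁿδᴺ≈δ : pow Δ n * pow δ N ≈ δ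
        Δⁿδᴺ≈δ = begin
          pow Δ n * pow δ N                        ≡⟨ ≡.cong (λ t → pow Δ n * pow δ t) N≡ ⟩
          pow Δ n * (δ * pow δ (2 ℕ.* n))          ≈⟨ solve 3 (λ a b c → a :* (b :* c) := b :* (a :* c)) refl _ δ _ ⟩
          δ * (pow Δ n * pow δ (2 ℕ.* n))          ≈⟨ *-congˡ (Δⁿδ²ⁿ≈1 n) ⟩
          δ * 1#                                   ≈⟨ *-identityʳ δ ⟩
          δ                                        ∎

    powers-of-v : ∀ r s n →
      (λ j → natR 2 * pow (v (r ℤ.* + j ℤ.+ s)) n)
        ≈ₛ sumS n (λ i →
             (natR (n C i) * Q (s ℤ.* + i)) •
             (quad (v (s ℤ.* (+ n ℤ.- + (2 ℕ.* i))))
                   (- (Q (s ℤ.* (+ n ℤ.- + (2 ℕ.* i)) ℤ.+ r ℤ.* + i)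
                       * v ((r ℤ.- s) ℤ.* (+ n ℤ.- + (2 ℕ.* i)))))
                   0#
              ⊘ quad 1#
                     (- (Q (r ℤ.* + i) * v (r ℤ.* (+ n ℤ.- + (2 ℕ.* i)))))
                     (Q (r ℤ.* + n))))
    powers-of-v r s n j =
      trans (*-cong (sym (*-identityʳ _)) (pow-congˡ n (trans (V-binet (k j)) (+-congˡ (sym (*-identityˡ _))))))
            (power-series v v≈ κ≈ (λ _ → refl) (λ _ → -‿cong (sym (*-identityˡ _))) refl j)
      where
      open Expansion 1# 1# 1# (*-identityˡ 1#) n (pow-1# n) r s
      v≈ : ∀ e → v e ≈ 1# * (α^ e + 1# * β^ e)
      v≈ e = trans (V-binet e) (sym (trans (*-identityˡ _) (+-congˡ (*-identityˡ _))))
      κ≈ : ∀ i → natR (n C i) * Q (s ℤ.* + i) ≈ pow 1# i * natR (n C i) * Q (s ℤ.* + i)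
      κ≈ i = *-congʳ (sym (trans (*-congʳ (pow-1# i)) (*-identityˡ _)))

corollary2 : ∀ {c ℓ} (R : CommutativeRing c ℓ) →
    let open CommutativeRing R hiding (zero) in
    let open Lucas R in
    IsAlgClosedFieldChar0 →
    (p q qinv : Carrier) →
    ¬ (p ≈ 0#) → ¬ (q ≈ 0#) → q * qinv ≈ 1# →
    ¬ (p * p - natR 4 * q ≈ 0#) →
    let Δ = p * p - natR 4 * q
        Q = zpow q qinv
        u = U p q qinv
        v = V p q qinv
    in
    (r s : ℤ) (n : ℕ) →
      ((λ j → natR 2 * pow Δ n * pow (u (r ℤ.* + j ℤ.+ s)) (2 ℕ.* n))
        ≈ₛ sumS (2 ℕ.* n) (λ i →
             (pow (- 1#) i * natR ((2 ℕ.* n) C i) * Q (s ℤ.* + i)) •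
             (quad (v (s ℤ.* (+ (2 ℕ.* n) ℤ.- + (2 ℕ.* i))))
                   (- (Q (s ℤ.* (+ (2 ℕ.* n) ℤ.- + (2 ℕ.* i)) ℤ.+ r ℤ.* + i)
                       * v ((r ℤ.- s) ℤ.* (+ (2 ℕ.* n) ℤ.- + (2 ℕ.* i)))))
                   0#
              ⊘ quad 1#
                     (- (Q (r ℤ.* + i) * v (r ℤ.* (+ (2 ℕ.* n) ℤ.- + (2 ℕ.* i)))))
                     (Q (+ 2 ℤ.* r ℤ.* + n)))))
      ×
      (1 ℕ.≤ n →
       (λ j → natR 2 * pow Δ (n ∸ 1) * pow (u (r ℤ.* + j ℤ.+ s)) (2 ℕ.* n ∸ 1))
        ≈ₛ sumS (2 ℕ.* n ∸ 1) (λ i →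
             (pow (- 1#) i * natR ((2 ℕ.* n ∸ 1) C i) * Q (s ℤ.* + i)) •
             (quad (u (s ℤ.* (+ (2 ℕ.* n ∸ 1) ℤ.- + (2 ℕ.* i))))
                   (Q (s ℤ.* (+ (2 ℕ.* n ∸ 1) ℤ.- + (2 ℕ.* i)) ℤ.+ r ℤ.* + i)
                     * u ((r ℤ.- s) ℤ.* (+ (2 ℕ.* n ∸ 1) ℤ.- + (2 ℕ.* i))))
                   0#
              ⊘ quad 1#
                     (- (Q (r ℤ.* + i) * v (r ℤ.* (+ (2 ℕ.* n ∸ 1) ℤ.- + (2 ℕ.* i)))))
                     (Q (+ (2 ℕ.* n ∸ 1) ℤ.* r)))))
      ×
      ((λ j → natR 2 * pow (v (r ℤ.* + j ℤ.+ s)) n)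
        ≈ₛ sumS n (λ i →
             (natR (n C i) * Q (s ℤ.* + i)) •
             (quad (v (s ℤ.* (+ n ℤ.- + (2 ℕ.* i))))
                   (- (Q (s ℤ.* (+ n ℤ.- + (2 ℕ.* i)) ℤ.+ r ℤ.* + i)
                       * v ((r ℤ.- s) ℤ.* (+ n ℤ.- + (2 ℕ.* i)))))
                   0#
              ⊘ quad 1#
                     (- (Q (r ℤ.* + i) * v (r ℤ.* (+ n ℤ.- + (2 ℕ.* i)))))
                     (Q (r ℤ.* + n)))))
corollary2 R alg p q q⁻¹ _ _ q*q⁻¹≈1 Δ≉0 r s n with quadratic-splits R alg p q
... | α , β , αβ≈q , α+β≈p with Roots.α-β-invertible R p q q⁻¹ α β q*q⁻¹≈1 αβ≈q α+β≈p alg Δ≉0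
... | δ , [α-β]δ≈1 = even-powers-of-u [α-β]δ≈1 r s n , odd-powers-of-u [α-β]δ≈1 r s n , powers-of-v r s n
  where open Roots R p q q⁻¹ α β q*q⁻¹≈1 αβ≈q α+β≈p
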